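{- For every even integer $n \geq 8$ there exists a nut graph $G$ of order $n$ with $o_v(G) = 1$ and $o_e(G) = 2$.
   Context: A nut graph is a simple connected graph $G$ whose adjacency matrix has one-dimensional kernel spanned by a vector with no zero entry. $o_v(G)$ and $o_e(G)$ denote the numbers of orbits of the full automorphism group $\mathrm{Aut}(G)$ on vertices and on edges, respectively. -}

module Defs where

open import Data.Nat using (ℕ; zero; suc)
open import Data.Fin using (Fin; zero; suc)
open import Data.Bool using (Bool; true; false; if_then_else_)
open import Data.Product using (Σ; ∃; ∃-syntax; _×_; _,_)
open import Data.Sum using (_⊎_)
open import Data.Rational using (ℚ; 0ℚ; 1ℚ; _+_; _*_)
open import Data.Fin.Permutation using (Permutation′; _⟨$⟩ʳ_)
open import Relation.Binary.PropositionalEquality using (_≡_)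
open import Relation.Nullary using (¬_)

record Graph (n : ℕ) : Set where
  field
    adj   : Fin n → Fin n → Bool
    sym   : ∀ u v → adj u v ≡ adj v u
    irref : ∀ u → adj u u ≡ false
open Graph public

data Reach {n : ℕ} (G : Graph n) : Fin n → Fin n → Set where
  here : ∀ {u} → Reach G u u
  step : ∀ {u v w} → adj G u v ≡ true → Reach G v w → Reach G u w

Connected : ∀ {n} → Graph n → Set
Connected {n} G = ∀ (u v : Fin n) → Reach G u v

sumℚ : ∀ {n} → (Fin n → ℚ) → ℚ
sumℚ {zero}  f = 0ℚ
sumℚ {suc n} f = f zero + sumℚ (λ i → f (suc i))

adjMat : ∀ {n} → Graph n → Fin n → Fin n → ℚ
adjMat G i j = if adj G i j then 1ℚ else 0ℚ

applyA : ∀ {n} → Graph n → (Fin n → ℚ) → (Fin n → ℚ)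
applyA G x i = sumℚ (λ j → adjMat G i j * x j)

InKernel : ∀ {n} → Graph n → (Fin n → ℚ) → Set
InKernel G x = ∀ i → applyA G x i ≡ 0ℚ

NutKernel : ∀ {n} → Graph n → Set
NutKernel {n} G = Σ (Fin n → ℚ) λ x →
  (∀ i → ¬ (x i ≡ 0ℚ)) × InKernel G x ×
  (∀ y → InKernel G y → ∃[ c ] (∀ i → y i ≡ c * x i))

IsNut : ∀ {n} → Graph n → Set
IsNut G = Connected G × NutKernel G

IsAut : ∀ {n} → Graph n → Permutation′ n → Set
IsAut {n} G σ = ∀ (u v : Fin n) → adj G (σ ⟨$⟩ʳ u) (σ ⟨$⟩ʳ v) ≡ adj G u v

Aut : ∀ {n} → Graph n → Set
Aut {n} G = Σ (Permutation′ n) (IsAut G)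

HasOrbits : (X : Set) → (X → X → Set) → ℕ → Set
HasOrbits X R k = Σ (Fin k → X) λ rep →
  (∀ x → ∃[ i ] R (rep i) x) × (∀ i j → R (rep i) (rep j) → i ≡ j)

VertexOrbitRel : ∀ {n} → Graph n → Fin n → Fin n → Set
VertexOrbitRel G u v = Σ (Aut G) λ { (σ , _) → σ ⟨$⟩ʳ u ≡ v }

-- Edges as (ordered) adjacent pairs; the orbit relation identifies
-- (u,v) with (v,u), so classes correspond to unordered edges.
Edge : ∀ {n} → Graph n → Set
Edge {n} G = Σ (Fin n × Fin n) λ { (u , v) → adj G u v ≡ true }

EdgeOrbitRel : ∀ {n} (G : Graph n) → Edge G → Edge G → Set
EdgeOrbitRel G ((a , b) , _) ((c , d) , _) = Σ (Aut G) λ { (σ , _) →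
  ((σ ⟨$⟩ʳ a ≡ c) × (σ ⟨$⟩ʳ b ≡ d)) ⊎ ((σ ⟨$⟩ʳ a ≡ d) × (σ ⟨$⟩ʳ b ≡ c)) }

o-v : ∀ {n} → Graph n → ℕ → Set
o-v {n} G k = HasOrbits (Fin n) (VertexOrbitRel G) k

o-e : ∀ {n} → Graph n → ℕ → Set
o-e G k = HasOrbits (Edge G) (EdgeOrbitRel G) k

-- The graph is the circulant graph on ℤ/n, n = 2(2a + 1 + e) with a ≥ 1 and e ∈ {1, 2}, in which
-- i is adjacent to i ± a and i ± (a + 1).  The alternating vector x_j = (-1)^j lies in its kernel.
-- For a kernel vector y, the kernel equation at j + a + 1 says that z_j = y_j + y_(j+1) satisfies
-- z_(j+2a+1) = -z_j; so z has the periods 2(2a + 1) and n, hence the period 2, hence z_(j+1) = -z_j.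
-- Then x_j z_j is a constant α and x_j y_j decreases by α at each step around the cycle, which
-- forces α = 0 and y = c x.  Rotations act transitively on the vertices and on the edges of each
-- length.  An automorphism maps x to ±x, so it preserves the product x_u x_v along edges, which is
-- (-1)^a on edges of length a and (-1)^(a+1) on edges of length a + 1: there are two edge orbits.

module Submission where

open import Defs hiding (sym)
open import Data.Bool using (Bool; true; if_then_else_)
open import Data.Empty using (⊥; ⊥-elim)
open import Data.Fin using (Fin; zero; suc; toℕ; fromℕ<; _≟_)
open import Data.Fin.Permutation using (Permutation′; _⟨$⟩ʳ_; permutation)
open import Data.Fin.Properties using (toℕ-fromℕ<; toℕ-injective; toℕ<n)
open import Data.Nat as ℕ using (ℕ; zero; suc; _+_; _*_; _∸_; _%_; _/_; _≤_; _<_; NonZero; >-nonZero⁻¹)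
open import Data.Nat.DivMod using (m%n<n; %-distribˡ-+; m%n%n≡m%n; [m+kn]%n≡m%n; m<n⇒m%n≡m; m≡m%n+[m/n]*n)
open import Data.Nat.Properties as ℕ using ()
open import Data.Product using (Σ; ∃-syntax; _×_; _,_; proj₁; proj₂)
open import Data.Rational as ℚ using (ℚ; 0ℚ; 1ℚ; -_)
open import Data.Rational.Properties as ℚ using (+-0-commutativeMonoid)
open import Data.Rational.Solver using (module +-*-Solver)
open import Data.Nat.Tactic.RingSolver using (solve-∀)
open import Data.Sum as Sum using (_⊎_; inj₁; inj₂)
open import Data.Sum.Function.Propositional using (_⊎-⇔_)
open import Function using (_∘_; _⇔_; mk⇔)
open import Relation.Binary.PropositionalEquality
open import Relation.Binary using (tri<; tri≈; tri>)
open import Relation.Nullary using (¬_; Dec; yes; no; does; contradiction)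
open import Relation.Nullary.Decidable using (_⊎-dec_; does-⇔; dec-true; dec-false)

open import Algebra.Properties.CommutativeMonoid.Sum +-0-commutativeMonoid
  using (sum; ∑-distrib-+; sum-permute)
open import Algebra.Definitions.RawMonoid ℚ.+-0-rawMonoid using () renaming (_×_ to _·_)
open import Algebra.Properties.Group ℚ.+-0-group using (identityʳ-unique; inverseˡ-unique; ⁻¹-involutive)
open +-*-Solver

𝟙 : Bool → ℚ
𝟙 b = if b then 1ℚ else 0ℚ

sumℚ≡sum : ∀ {n} (f : Fin n → ℚ) → sumℚ f ≡ sum f
sumℚ≡sum {zero}  f = refl
sumℚ≡sum {suc n} f = cong (f zero ℚ.+_) (sumℚ≡sum (f ∘ suc))

sumℚ-cong : ∀ {n} {f g : Fin n → ℚ} → (∀ j → f j ≡ g j) → sumℚ f ≡ sumℚ g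
sumℚ-cong {zero}  f≗g = refl
sumℚ-cong {suc n} f≗g = cong₂ ℚ._+_ (f≗g zero) (sumℚ-cong (f≗g ∘ suc))

sumℚ-+ : ∀ {n} (f g : Fin n → ℚ) → sumℚ (λ j → f j ℚ.+ g j) ≡ sumℚ f ℚ.+ sumℚ g
sumℚ-+ f g = begin
  sumℚ (λ j → f j ℚ.+ g j) ≡⟨ sumℚ≡sum (λ j → f j ℚ.+ g j) ⟩
  sum (λ j → f j ℚ.+ g j)  ≡⟨ ∑-distrib-+ f g ⟩
  sum f ℚ.+ sum g          ≡⟨ cong₂ ℚ._+_ (sumℚ≡sum f) (sumℚ≡sum g) ⟨
  sumℚ f ℚ.+ sumℚ g        ∎
  where open ≡-Reasoning

sumℚ-permute : ∀ {n} (f : Fin n → ℚ) (σ : Permutation′ n) → sumℚ f ≡ sumℚ (f ∘ (σ ⟨$⟩ʳ_))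
sumℚ-permute f σ = begin
  sumℚ f                 ≡⟨ sumℚ≡sum f ⟩
  sum f                  ≡⟨ sum-permute f σ ⟩
  sum (f ∘ (σ ⟨$⟩ʳ_))    ≡⟨ sumℚ≡sum (f ∘ (σ ⟨$⟩ʳ_)) ⟨
  sumℚ (f ∘ (σ ⟨$⟩ʳ_))   ∎
  where open ≡-Reasoning

sumℚ-zero : ∀ n → sumℚ {n} (λ _ → 0ℚ) ≡ 0ℚ
sumℚ-zero zero    = refl
sumℚ-zero (suc n) = cong (0ℚ ℚ.+_) (sumℚ-zero n)

module _ {n : ℕ} where

  sumOver : {P : Fin n → Set} → (∀ j → Dec (P j)) → (Fin n → ℚ) → ℚ
  sumOver P? y = sumℚ (λ j → 𝟙 (does (P? j)) ℚ.* y j)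

  sumOver-cong : {P Q : Fin n → Set} (P? : ∀ j → Dec (P j)) (Q? : ∀ j → Dec (Q j)) →
                 (∀ j → P j ⇔ Q j) → ∀ y → sumOver P? y ≡ sumOver Q? y
  sumOver-cong P? Q? P⇔Q y = sumℚ-cong λ j → cong (λ b → 𝟙 b ℚ.* y j) (does-⇔ (P⇔Q j) (P? j) (Q? j))

  sumOver-⊎ : {P Q : Fin n → Set} (P? : ∀ j → Dec (P j)) (Q? : ∀ j → Dec (Q j)) →
              (∀ j → ¬ (P j × Q j)) →
              ∀ y → sumOver (λ j → P? j ⊎-dec Q? j) y ≡ sumOver P? y ℚ.+ sumOver Q? y
  sumOver-⊎ P? Q? disjoint y =
    trans (sumℚ-cong split) (sumℚ-+ (λ j → 𝟙 (does (P? j)) ℚ.* y j) (λ j → 𝟙 (does (Q? j)) ℚ.* y j))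
    where
    split : ∀ j → 𝟙 (does (P? j ⊎-dec Q? j)) ℚ.* y j ≡ 𝟙 (does (P? j)) ℚ.* y j ℚ.+ 𝟙 (does (Q? j)) ℚ.* y j
    split j with P? j | Q? j
    ... | yes p | yes q = contradiction (p , q) (disjoint j)
    ... | yes _ | no _  = solve 1 (λ v → con 1ℚ :* v := con 1ℚ :* v :+ con 0ℚ :* v) refl (y j)
    ... | no _  | yes _ = solve 1 (λ v → con 1ℚ :* v := con 0ℚ :* v :+ con 1ℚ :* v) refl (y j)
    ... | no _  | no _  = solve 1 (λ v → con 0ℚ :* v := con 0ℚ :* v :+ con 0ℚ :* v) refl (y j)

sumOver-singleton : ∀ {n} (k : Fin n) y → sumOver (_≟ k) y ≡ y k
sumOver-singleton {suc n} zero y = begin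
  1ℚ ℚ.* y zero ℚ.+ sumℚ (λ j → 0ℚ ℚ.* y (suc j))
    ≡⟨ cong₂ ℚ._+_ (ℚ.*-identityˡ (y zero)) (sumℚ-cong (λ j → ℚ.*-zeroˡ (y (suc j)))) ⟩
  y zero ℚ.+ sumℚ {n} (λ _ → 0ℚ)
    ≡⟨ cong (y zero ℚ.+_) (sumℚ-zero n) ⟩
  y zero ℚ.+ 0ℚ
    ≡⟨ ℚ.+-identityʳ (y zero) ⟩
  y zero ∎
  where open ≡-Reasoning
sumOver-singleton {suc n} (suc k) y = begin
  0ℚ ℚ.* y zero ℚ.+ sumOver (_≟ k) (y ∘ suc)
    ≡⟨ cong₂ ℚ._+_ (ℚ.*-zeroˡ (y zero)) (sumOver-singleton k (y ∘ suc)) ⟩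
  0ℚ ℚ.+ y (suc k)
    ≡⟨ ℚ.+-identityˡ (y (suc k)) ⟩
  y (suc k) ∎
  where open ≡-Reasoning

sgn : ℕ → ℚ
sgn zero    = 1ℚ
sgn (suc k) = - sgn k

sgn-+ : ∀ p q → sgn (p + q) ≡ sgn p ℚ.* sgn q
sgn-+ zero    q = sym (ℚ.*-identityˡ (sgn q))
sgn-+ (suc p) q = trans (cong -_ (sgn-+ p q)) (ℚ.neg-distribˡ-* (sgn p) (sgn q))

sgn-square : ∀ k → sgn k ℚ.* sgn k ≡ 1ℚ
sgn-square zero    = refl
sgn-square (suc k) = trans (solve 1 (λ s → (:- s) :* (:- s) := s :* s) refl (sgn k)) (sgn-square k)

sgn-double : ∀ k → sgn (2 * k) ≡ 1ℚ
sgn-double k = begin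
  sgn (k + (k + 0))       ≡⟨ cong (λ t → sgn (k + t)) (ℕ.+-identityʳ k) ⟩
  sgn (k + k)             ≡⟨ sgn-+ k k ⟩
  sgn k ℚ.* sgn k         ≡⟨ sgn-square k ⟩
  1ℚ                      ∎
  where open ≡-Reasoning

sgn-%-even : ∀ m .{{_ : NonZero (2 * m)}} t → sgn (t % (2 * m)) ≡ sgn t
sgn-%-even m t = sym (begin
  sgn t                                         ≡⟨ cong sgn (m≡m%n+[m/n]*n t (2 * m)) ⟩
  sgn (t % (2 * m) + q * (2 * m))               ≡⟨ sgn-+ (t % (2 * m)) (q * (2 * m)) ⟩
  sgn (t % (2 * m)) ℚ.* sgn (q * (2 * m))       ≡⟨ cong (λ k → sgn (t % (2 * m)) ℚ.* sgn k) (rearrange q m) ⟩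
  sgn (t % (2 * m)) ℚ.* sgn (2 * (q * m))       ≡⟨ cong (sgn (t % (2 * m)) ℚ.*_) (sgn-double (q * m)) ⟩
  sgn (t % (2 * m)) ℚ.* 1ℚ                      ≡⟨ ℚ.*-identityʳ _ ⟩
  sgn (t % (2 * m))                             ∎)
  where
  open ≡-Reasoning
  q : ℕ
  q = t / (2 * m)
  rearrange : ∀ x y → x * (2 * y) ≡ 2 * (x * y)
  rearrange = solve-∀

square-one⇒≢0 : ∀ {s} → s ℚ.* s ≡ 1ℚ → s ≢ 0ℚ
square-one⇒≢0 s²≡1 refl = contradiction s²≡1 λ ()

square-one⇒≢-neg : ∀ {s} → s ℚ.* s ≡ 1ℚ → s ≢ - s
square-one⇒≢-neg {s} s²≡1 s≡-s = contradiction 1≡-1 λ ()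
  where
  1≡-1 : 1ℚ ≡ - 1ℚ
  1≡-1 = begin
    1ℚ            ≡⟨ s²≡1 ⟨
    s ℚ.* s       ≡⟨ cong (s ℚ.*_) s≡-s ⟩
    s ℚ.* - s     ≡⟨ ℚ.neg-distribʳ-* s s ⟨
    - (s ℚ.* s)   ≡⟨ cong -_ s²≡1 ⟩
    - 1ℚ          ∎
    where open ≡-Reasoning

·-nonPos : ∀ k {d} → d ℚ.≤ 0ℚ → k · d ℚ.≤ 0ℚ
·-nonPos zero    d≤0 = ℚ.≤-refl
·-nonPos (suc k) d≤0 = ℚ.+-mono-≤ d≤0 (·-nonPos k d≤0)

·-nonNeg : ∀ k {d} → 0ℚ ℚ.≤ d → 0ℚ ℚ.≤ k · d
·-nonNeg zero    0≤d = ℚ.≤-refl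
·-nonNeg (suc k) 0≤d = ℚ.+-mono-≤ 0≤d (·-nonNeg k 0≤d)

·-zero⇒zero : ∀ k .{{_ : NonZero k}} {d} → k · d ≡ 0ℚ → d ≡ 0ℚ
·-zero⇒zero (suc k) {d} kd≡0 with ℚ.<-cmp d 0ℚ
... | tri< d<0 _ _ = contradiction kd≡0 (ℚ.<⇒≢ (ℚ.+-mono-<-≤ d<0 (·-nonPos k (ℚ.<⇒≤ d<0))))
... | tri≈ _ d≡0 _ = d≡0
... | tri> _ _ d>0 = contradiction (sym kd≡0) (ℚ.<⇒≢ (ℚ.+-mono-<-≤ d>0 (·-nonNeg k (ℚ.<⇒≤ d>0))))

Reach-trans : ∀ {n} {G : Graph n} {u v w} → Reach G u v → Reach G v w → Reach G u w
Reach-trans here         v⇝w = v⇝w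
Reach-trans (step uv u⇝v) v⇝w = step uv (Reach-trans u⇝v v⇝w)

InKernel-∘-aut : ∀ {n} (G : Graph n) ((σ , _) : Aut G) {y} → InKernel G y → InKernel G (y ∘ (σ ⟨$⟩ʳ_))
InKernel-∘-aut G (σ , σ-aut) {y} y-ker i = begin
  sumℚ (λ j → 𝟙 (adj G i j) ℚ.* y (σ ⟨$⟩ʳ j))
    ≡⟨ sumℚ-cong (λ j → cong (λ b → 𝟙 b ℚ.* y (σ ⟨$⟩ʳ j)) (σ-aut i j)) ⟨
  sumℚ (λ j → 𝟙 (adj G (σ ⟨$⟩ʳ i) (σ ⟨$⟩ʳ j)) ℚ.* y (σ ⟨$⟩ʳ j))
    ≡⟨ sumℚ-permute (λ j → 𝟙 (adj G (σ ⟨$⟩ʳ i) j) ℚ.* y j) σ ⟨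
  applyA G y (σ ⟨$⟩ʳ i)
    ≡⟨ y-ker (σ ⟨$⟩ʳ i) ⟩
  0ℚ ∎
  where open ≡-Reasoning

module SignKernel {n} (G : Graph n) (x : Fin n → ℚ) (x-square : ∀ i → x i ℚ.* x i ≡ 1ℚ)
                  (x-ker : InKernel G x)
                  (x-spans : ∀ y → InKernel G y → ∃[ c ] (∀ i → y i ≡ c ℚ.* x i)) where

  nutKernel : NutKernel G
  nutKernel = x , (λ i → square-one⇒≢0 (x-square i)) , x-ker , x-spans

  aut-preserves-product : ((σ , _) : Aut G) → ∀ u v → x (σ ⟨$⟩ʳ u) ℚ.* x (σ ⟨$⟩ʳ v) ≡ x u ℚ.* x v
  aut-preserves-product (σ , σ-aut) u v = begin
    x (σ ⟨$⟩ʳ u) ℚ.* x (σ ⟨$⟩ʳ v)     ≡⟨ cong₂ ℚ._*_ (x∘σ≡cx u) (x∘σ≡cx v) ⟩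
    (c ℚ.* x u) ℚ.* (c ℚ.* x v)       ≡⟨ solve 3 (λ c s t → (c :* s) :* (c :* t) := (c :* c) :* (s :* t))
                                                 refl c (x u) (x v) ⟩
    (c ℚ.* c) ℚ.* (x u ℚ.* x v)       ≡⟨ cong (ℚ._* (x u ℚ.* x v)) c²≡1 ⟩
    1ℚ ℚ.* (x u ℚ.* x v)              ≡⟨ ℚ.*-identityˡ (x u ℚ.* x v) ⟩
    x u ℚ.* x v                       ∎
    where
    open ≡-Reasoning
    c : ℚ
    c = proj₁ (x-spans (x ∘ (σ ⟨$⟩ʳ_)) (InKernel-∘-aut G (σ , σ-aut) x-ker))
    x∘σ≡cx : ∀ i → x (σ ⟨$⟩ʳ i) ≡ c ℚ.* x i
    x∘σ≡cx = proj₂ (x-spans (x ∘ (σ ⟨$⟩ʳ_)) (InKernel-∘-aut G (σ , σ-aut) x-ker))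
    c²≡1 : c ℚ.* c ≡ 1ℚ
    c²≡1 = begin
      c ℚ.* c                           ≡⟨ ℚ.*-identityʳ (c ℚ.* c) ⟨
      (c ℚ.* c) ℚ.* 1ℚ                  ≡⟨ cong ((c ℚ.* c) ℚ.*_) (x-square u) ⟨
      (c ℚ.* c) ℚ.* (x u ℚ.* x u)       ≡⟨ solve 2 (λ c s → (c :* c) :* (s :* s) := (c :* s) :* (c :* s))
                                                   refl c (x u) ⟩
      (c ℚ.* x u) ℚ.* (c ℚ.* x u)       ≡⟨ cong₂ ℚ._*_ (x∘σ≡cx u) (x∘σ≡cx u) ⟨
      x (σ ⟨$⟩ʳ u) ℚ.* x (σ ⟨$⟩ʳ u)     ≡⟨ x-square (σ ⟨$⟩ʳ u) ⟩
      1ℚ                                ∎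

  edgeProduct : Edge G → ℚ
  edgeProduct ((u , v) , _) = x u ℚ.* x v

  edgeProduct-square : ∀ e → edgeProduct e ℚ.* edgeProduct e ≡ 1ℚ
  edgeProduct-square ((u , v) , _) = begin
    (x u ℚ.* x v) ℚ.* (x u ℚ.* x v)   ≡⟨ solve 2 (λ s t → (s :* t) :* (s :* t) := (s :* s) :* (t :* t))
                                               refl (x u) (x v) ⟩
    (x u ℚ.* x u) ℚ.* (x v ℚ.* x v)   ≡⟨ cong₂ ℚ._*_ (x-square u) (x-square v) ⟩
    1ℚ                                ∎
    where open ≡-Reasoning

  edgeOrbit-preserves-product : ∀ e f → EdgeOrbitRel G e f → edgeProduct e ≡ edgeProduct f
  edgeOrbit-preserves-product ((u , v) , _) ((u′ , v′) , _) (σ , inj₁ (σu≡u′ , σv≡v′)) =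
    trans (sym (aut-preserves-product σ u v)) (cong₂ ℚ._*_ (cong x σu≡u′) (cong x σv≡v′))
  edgeOrbit-preserves-product ((u , v) , _) ((u′ , v′) , _) (σ , inj₂ (σu≡v′ , σv≡u′)) =
    trans (sym (aut-preserves-product σ u v))
          (trans (cong₂ ℚ._*_ (cong x σu≡v′) (cong x σv≡u′)) (ℚ.*-comm (x v′) (x u′)))

module Rotation (n : ℕ) {{_ : NonZero n}} where

  infixl 6 _⊕_ _⊖_

  _⊕_ : Fin n → ℕ → Fin n
  i ⊕ p = fromℕ< (m%n<n (toℕ i + p) n)

  -- p * n ∸ p represents -p modulo n without truncation, for every p.
  _⊖_ : Fin n → ℕ → Fin n
  i ⊖ p = i ⊕ (p * n ∸ p)

  origin : Fin n
  origin = fromℕ< (>-nonZero⁻¹ n)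

  toℕ-⊕ : ∀ i p → toℕ (i ⊕ p) ≡ (toℕ i + p) % n
  toℕ-⊕ i p = toℕ-fromℕ< (m%n<n (toℕ i + p) n)

  ⊕-≡ : ∀ i p {j} → (toℕ i + p) % n ≡ toℕ j → i ⊕ p ≡ j
  ⊕-≡ i p eq = toℕ-injective (trans (toℕ-⊕ i p) eq)

  ⊕-assoc : ∀ i p q → i ⊕ p ⊕ q ≡ i ⊕ (p + q)
  ⊕-assoc i p q = ⊕-≡ (i ⊕ p) q (begin
    (toℕ (i ⊕ p) + q) % n               ≡⟨ cong (λ t → (t + q) % n) (toℕ-⊕ i p) ⟩
    ((toℕ i + p) % n + q) % n           ≡⟨ %-distribˡ-+ ((toℕ i + p) % n) q n ⟩
    ((toℕ i + p) % n % n + q % n) % n   ≡⟨ cong (λ t → (t + q % n) % n) (m%n%n≡m%n (toℕ i + p) n) ⟩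
    ((toℕ i + p) % n + q % n) % n       ≡⟨ %-distribˡ-+ (toℕ i + p) q n ⟨
    (toℕ i + p + q) % n                 ≡⟨ cong (_% n) (ℕ.+-assoc (toℕ i) p q) ⟩
    (toℕ i + (p + q)) % n               ≡⟨ toℕ-⊕ i (p + q) ⟨
    toℕ (i ⊕ (p + q))                   ∎)
    where open ≡-Reasoning

  ⊕-comm : ∀ i p q → i ⊕ p ⊕ q ≡ i ⊕ q ⊕ p
  ⊕-comm i p q = trans (⊕-assoc i p q) (trans (cong (i ⊕_) (ℕ.+-comm p q)) (sym (⊕-assoc i q p)))

  ⊕-identityʳ : ∀ i → i ⊕ 0 ≡ i
  ⊕-identityʳ i = ⊕-≡ i 0 (trans (cong (_% n) (ℕ.+-identityʳ (toℕ i))) (m<n⇒m%n≡m (toℕ<n i)))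

  ⊕-multiple : ∀ k i → i ⊕ k * n ≡ i
  ⊕-multiple k i = ⊕-≡ i (k * n) (trans ([m+kn]%n≡m%n (toℕ i) k n) (m<n⇒m%n≡m (toℕ<n i)))

  ⊕-period : ∀ i → i ⊕ n ≡ i
  ⊕-period i = trans (cong (i ⊕_) (sym (ℕ.*-identityˡ n))) (⊕-multiple 1 i)

  ⊕-⊖ : ∀ i p → i ⊕ p ⊖ p ≡ i
  ⊕-⊖ i p = begin
    i ⊕ p ⊕ (p * n ∸ p)   ≡⟨ ⊕-assoc i p (p * n ∸ p) ⟩
    i ⊕ (p + (p * n ∸ p)) ≡⟨ cong (i ⊕_) (ℕ.m+[n∸m]≡n (ℕ.m≤m*n p n)) ⟩
    i ⊕ p * n             ≡⟨ ⊕-multiple p i ⟩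
    i                     ∎
    where open ≡-Reasoning

  ⊖-⊕ : ∀ i p → i ⊖ p ⊕ p ≡ i
  ⊖-⊕ i p = begin
    i ⊕ (p * n ∸ p) ⊕ p   ≡⟨ ⊕-assoc i (p * n ∸ p) p ⟩
    i ⊕ (p * n ∸ p + p)   ≡⟨ cong (i ⊕_) (ℕ.m∸n+n≡m (ℕ.m≤m*n p n)) ⟩
    i ⊕ p * n             ≡⟨ ⊕-multiple p i ⟩
    i                     ∎
    where open ≡-Reasoning

  ⊕-injective : ∀ {i j} p → i ⊕ p ≡ j ⊕ p → i ≡ j
  ⊕-injective {i} {j} p eq = trans (sym (⊕-⊖ i p)) (trans (cong (_⊖ p) eq) (⊕-⊖ j p))

  ⊕⇔⊖ : ∀ {i j} p → i ≡ j ⊕ p ⇔ j ≡ i ⊖ p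
  ⊕⇔⊖ {i} {j} p = mk⇔ (λ i≡j⊕p → trans (sym (⊕-⊖ j p)) (cong (_⊖ p) (sym i≡j⊕p)))
                       (λ j≡i⊖p → trans (sym (⊖-⊕ i p)) (cong (_⊕ p) (sym j≡i⊖p)))

  rotation : ℕ → Permutation′ n
  rotation p = permutation (_⊕ p) (_⊖ p) (λ i → ⊖-⊕ i p) (λ i → ⊕-⊖ i p)

  origin-⊕ : ∀ j → origin ⊕ toℕ j ≡ j
  origin-⊕ j = ⊕-≡ origin (toℕ j) (trans (cong (λ t → (t + toℕ j) % n) (toℕ-fromℕ< (>-nonZero⁻¹ n)))
                          (m<n⇒m%n≡m (toℕ<n j)))

  origin-⊕-⊕ : ∀ u p → origin ⊕ p ⊕ toℕ u ≡ u ⊕ p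
  origin-⊕-⊕ u p = trans (⊕-comm origin p (toℕ u)) (cong (_⊕ p) (origin-⊕ u))

  ⊕-fixedPointFree : ∀ {d} i → 0 < d → d < n → i ⊕ d ≢ i
  ⊕-fixedPointFree {d} i 0<d d<n i⊕d≡i = ℕ.<⇒≢ 0<d (sym d≡0)
    where
    origin⊕d≡origin : origin ⊕ d ≡ origin
    origin⊕d≡origin = ⊕-injective (toℕ i) (begin
      origin ⊕ d ⊕ toℕ i   ≡⟨ origin-⊕-⊕ i d ⟩
      i ⊕ d                ≡⟨ i⊕d≡i ⟩
      i                    ≡⟨ origin-⊕ i ⟨
      origin ⊕ toℕ i       ∎)
      where open ≡-Reasoning
    d≡0 : d ≡ 0
    d≡0 = begin
      d                      ≡⟨ m<n⇒m%n≡m d<n ⟨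
      (0 + d) % n            ≡⟨ cong (λ t → (t + d) % n) (toℕ-fromℕ< (>-nonZero⁻¹ n)) ⟨
      (toℕ origin + d) % n   ≡⟨ toℕ-⊕ origin d ⟨
      toℕ (origin ⊕ d)       ≡⟨ cong toℕ origin⊕d≡origin ⟩
      toℕ origin             ≡⟨ toℕ-fromℕ< (>-nonZero⁻¹ n) ⟩
      0                      ∎
      where open ≡-Reasoning

  ⊕-offsetsDistinct : ∀ {p q} i → p < q → q < n → i ⊕ p ≢ i ⊕ q
  ⊕-offsetsDistinct {p} {q} i p<q q<n i⊕p≡i⊕q =
    ⊕-fixedPointFree (i ⊕ p) (ℕ.m<n⇒0<n∸m p<q) (ℕ.≤-<-trans (ℕ.m∸n≤m q p) q<n) (begin
      i ⊕ p ⊕ (q ∸ p)   ≡⟨ ⊕-assoc i p (q ∸ p) ⟩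
      i ⊕ (p + (q ∸ p)) ≡⟨ cong (i ⊕_) (ℕ.m+[n∸m]≡n (ℕ.<⇒≤ p<q)) ⟩
      i ⊕ q             ≡⟨ i⊕p≡i⊕q ⟨
      i ⊕ p             ∎)
    where open ≡-Reasoning

  ⊕-suc : ∀ i k → i ⊕ suc k ≡ i ⊕ k ⊕ 1
  ⊕-suc i k = trans (cong (i ⊕_) (ℕ.+-comm 1 k)) (sym (⊕-assoc i k 1))

  ⊕1-induction : (P : Fin n → Set) → P origin → (∀ j → P j → P (j ⊕ 1)) → ∀ j → P j
  ⊕1-induction P base advance j = subst P (origin-⊕ j) (reached (toℕ j))
    where
    reached : ∀ k → P (origin ⊕ k)
    reached zero    = subst P (sym (⊕-identityʳ origin)) base
    reached (suc k) = subst P (sym (⊕-suc origin k)) (advance (origin ⊕ k) (reached k))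

  ⊕1-invariant⇒constant : {A : Set} (f : Fin n → A) → (∀ j → f (j ⊕ 1) ≡ f j) → ∀ j → f j ≡ f origin
  ⊕1-invariant⇒constant f invariant =
    ⊕1-induction (λ j → f j ≡ f origin) refl (λ j eq → trans (invariant j) eq)

  ⊕1-drift⇒zero : (f : Fin n → ℚ) (d : ℚ) → (∀ j → f (j ⊕ 1) ≡ f j ℚ.+ d) → d ≡ 0ℚ
  ⊕1-drift⇒zero f d drift = ·-zero⇒zero n (identityʳ-unique (f origin) (n · d) (sym (begin
      f origin               ≡⟨ cong f (⊕-period origin) ⟨
      f (origin ⊕ n)         ≡⟨ iterate n ⟩
      f origin ℚ.+ n · d     ∎)))
    where
    open ≡-Reasoning
    iterate : ∀ k → f (origin ⊕ k) ≡ f origin ℚ.+ k · d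
    iterate zero    = trans (cong f (⊕-identityʳ origin)) (sym (ℚ.+-identityʳ (f origin)))
    iterate (suc k) = begin
      f (origin ⊕ suc k)            ≡⟨ cong f (⊕-suc origin k) ⟩
      f (origin ⊕ k ⊕ 1)            ≡⟨ drift (origin ⊕ k) ⟩
      f (origin ⊕ k) ℚ.+ d          ≡⟨ cong (ℚ._+ d) (iterate k) ⟩
      f origin ℚ.+ k · d ℚ.+ d      ≡⟨ solve 3 (λ a b c → a :+ b :+ c := a :+ (c :+ b))
                                               refl (f origin) (k · d) d ⟩
      f origin ℚ.+ (d ℚ.+ k · d)    ∎

  Periodic : {A : Set} → (Fin n → A) → ℕ → Set
  Periodic f p = ∀ j → f (j ⊕ p) ≡ f j

  module _ {A : Set} {f : Fin n → A} where

    periodic-n : Periodic f n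
    periodic-n j = cong f (⊕-period j)

    periodic-+ : ∀ {p q} → Periodic f p → Periodic f q → Periodic f (p + q)
    periodic-+ {p} {q} f-p f-q j = trans (cong f (sym (⊕-assoc j p q))) (trans (f-q (j ⊕ p)) (f-p j))

    periodic-*ˡ : ∀ {p} k → Periodic f p → Periodic f (k * p)
    periodic-*ˡ zero    f-p j = cong f (⊕-identityʳ j)
    periodic-*ˡ (suc k) f-p   = periodic-+ f-p (periodic-*ˡ k f-p)

    periodic-cancelˡ : ∀ {p q} → Periodic f p → Periodic f (p + q) → Periodic f q
    periodic-cancelˡ {p} {q} f-p f-p+q j = begin
      f (j ⊕ q)         ≡⟨ f-p (j ⊕ q) ⟨
      f (j ⊕ q ⊕ p)     ≡⟨ cong f (⊕-comm j q p) ⟩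
      f (j ⊕ p ⊕ q)     ≡⟨ cong f (⊕-assoc j p q) ⟩
      f (j ⊕ (p + q))   ≡⟨ f-p+q j ⟩
      f j               ∎
      where open ≡-Reasoning

  ⊕-noReturn : ∀ {p q i j} → 0 < p + q → p + q < n → j ≡ i ⊕ p → i ≡ j ⊕ q → ⊥
  ⊕-noReturn {p} {q} {i} {j} 0<p+q p+q<n j≡i⊕p i≡j⊕q =
    ⊕-fixedPointFree i 0<p+q p+q<n (sym (begin
      i             ≡⟨ i≡j⊕q ⟩
      j ⊕ q         ≡⟨ cong (_⊕ q) j≡i⊕p ⟩
      i ⊕ p ⊕ q     ≡⟨ ⊕-assoc i p q ⟩
      i ⊕ (p + q)   ∎))
    where open ≡-Reasoning

  ⊕-difference : ∀ u v → u ⊕ toℕ (v ⊖ toℕ u) ≡ v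
  ⊕-difference u v = begin
    u ⊕ toℕ w                    ≡⟨ origin-⊕-⊕ u (toℕ w) ⟨
    origin ⊕ toℕ w ⊕ toℕ u       ≡⟨ cong (_⊕ toℕ u) (origin-⊕ w) ⟩
    w ⊕ toℕ u                    ≡⟨ ⊖-⊕ v (toℕ u) ⟩
    v                            ∎
    where
    open ≡-Reasoning
    w : Fin n
    w = v ⊖ toℕ u

  Link : ℕ → Fin n → Fin n → Set
  Link p i j = j ≡ i ⊕ p ⊎ i ≡ j ⊕ p

  link? : ∀ p i j → Dec (Link p i j)
  link? p i j = (j ≟ i ⊕ p) ⊎-dec (i ≟ j ⊕ p)

  Link-sym : ∀ {p i j} → Link p i j ⇔ Link p j i
  Link-sym = mk⇔ Sum.swap Sum.swap

  Link-irrefl : ∀ {p} i → 0 < p → p < n → ¬ Link p i i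
  Link-irrefl i 0<p p<n (inj₁ i≡i⊕p) = ⊕-fixedPointFree i 0<p p<n (sym i≡i⊕p)
  Link-irrefl i 0<p p<n (inj₂ i≡i⊕p) = ⊕-fixedPointFree i 0<p p<n (sym i≡i⊕p)

  Link-disjoint : ∀ {p q} → 0 < p → p < q → p + q < n → ∀ {i j} → ¬ (Link p i j × Link q i j)
  Link-disjoint {p} {q} 0<p p<q p+q<n {i} {j} = disjoint
    where
    q<n : q < n
    q<n = ℕ.≤-<-trans (ℕ.m≤n+m q p) p+q<n
    0<p+q : 0 < p + q
    0<p+q = ℕ.<-≤-trans 0<p (ℕ.m≤m+n p q)
    disjoint : ¬ (Link p i j × Link q i j)
    disjoint (inj₁ j≡i⊕p , inj₁ j≡i⊕q) = ⊕-offsetsDistinct i p<q q<n (trans (sym j≡i⊕p) j≡i⊕q)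
    disjoint (inj₁ j≡i⊕p , inj₂ i≡j⊕q) = ⊕-noReturn 0<p+q p+q<n j≡i⊕p i≡j⊕q
    disjoint (inj₂ i≡j⊕p , inj₁ j≡i⊕q) = ⊕-noReturn 0<p+q p+q<n i≡j⊕p j≡i⊕q
    disjoint (inj₂ i≡j⊕p , inj₂ i≡j⊕q) = ⊕-offsetsDistinct j p<q q<n (trans (sym i≡j⊕p) i≡j⊕q)

  Link-⊕ : ∀ p k {i j} → Link p (i ⊕ k) (j ⊕ k) ⇔ Link p i j
  Link-⊕ p k = shift⇔ ⊎-⇔ shift⇔
    where
    shift⇔ : ∀ {i j} → j ⊕ k ≡ i ⊕ k ⊕ p ⇔ j ≡ i ⊕ p
    shift⇔ {i} = mk⇔ (λ eq → ⊕-injective k (trans eq (⊕-comm i k p)))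
                     (λ eq → trans (cong (_⊕ k) eq) (⊕-comm i p k))

  sumOver-link : ∀ {p} → 0 < p + p → p + p < n →
                 ∀ y i → sumOver (link? p i) y ≡ y (i ⊕ p) ℚ.+ y (i ⊖ p)
  sumOver-link {p} 0<2p 2p<n y i = begin
    sumOver (link? p i) y
      ≡⟨ sumOver-⊎ (_≟ i ⊕ p) (λ j → i ≟ j ⊕ p)
                   (λ j (j≡i⊕p , i≡j⊕p) → ⊕-noReturn 0<2p 2p<n j≡i⊕p i≡j⊕p) y ⟩
    sumOver (_≟ i ⊕ p) y ℚ.+ sumOver (λ j → i ≟ j ⊕ p) y
      ≡⟨ cong (sumOver (_≟ i ⊕ p) y ℚ.+_)
              (sumOver-cong (λ j → i ≟ j ⊕ p) (_≟ i ⊖ p) (λ j → ⊕⇔⊖ p) y) ⟩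
    sumOver (_≟ i ⊕ p) y ℚ.+ sumOver (_≟ i ⊖ p) y
      ≡⟨ cong₂ ℚ._+_ (sumOver-singleton (i ⊕ p) y) (sumOver-singleton (i ⊖ p) y) ⟩
    y (i ⊕ p) ℚ.+ y (i ⊖ p) ∎
    where open ≡-Reasoning

  connected-via-⊕1 : (G : Graph n) → (∀ j → Reach G j (j ⊕ 1)) → Connected G
  connected-via-⊕1 G reach-⊕1 u v = subst (Reach G u) (⊕-difference u v) (reach-⊕ (toℕ (v ⊖ toℕ u)) u)
    where
    reach-⊕ : ∀ k i → Reach G i (i ⊕ k)
    reach-⊕ zero    i = subst (Reach G i) (sym (⊕-identityʳ i)) here
    reach-⊕ (suc k) i = subst (Reach G i) (sym (⊕-suc i k)) (Reach-trans (reach-⊕ k i) (reach-⊕1 (i ⊕ k)))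

module Circulant (a e : ℕ) (0<a : 0 < a) (e∈ : e ≡ 1 ⊎ e ≡ 2) where

  S : ℕ
  S = suc (a + a)

  n : ℕ
  n = 2 * (S + e)

  open Rotation n

  0<e : 0 < e
  0<e = positive e∈
    where
    positive : ∀ {k} → k ≡ 1 ⊎ k ≡ 2 → 0 < k
    positive (inj₁ refl) = ℕ.z<s
    positive (inj₂ refl) = ℕ.z<s

  2a+2<n : suc a + suc a < n
  2a+2<n = begin-strict
    suc a + suc a          ≡⟨ cong (suc a +_) (ℕ.+-identityʳ (suc a)) ⟨
    2 * suc a              <⟨ ℕ.*-monoʳ-< 2 (ℕ.s<s (ℕ.≤-<-trans (ℕ.m≤m+n a a) (ℕ.m<m+n (a + a) 0<e))) ⟩
    n                      ∎
    where open ℕ.≤-Reasoning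

  a+a+1<n : a + suc a < n
  a+a+1<n = ℕ.<-trans (ℕ.n<1+n (a + suc a)) 2a+2<n

  a+1<n : suc a < n
  a+1<n = ℕ.≤-<-trans (ℕ.m≤n+m (suc a) a) a+a+1<n

  Adj : Fin n → Fin n → Set
  Adj i j = Link a i j ⊎ Link (suc a) i j

  adj? : ∀ i j → Dec (Adj i j)
  adj? i j = link? a i j ⊎-dec link? (suc a) i j

  Adj-irrefl : ∀ i → ¬ Adj i i
  Adj-irrefl i (inj₁ link) = Link-irrefl i 0<a (ℕ.<-trans (ℕ.n<1+n a) a+1<n) link
  Adj-irrefl i (inj₂ link) = Link-irrefl i ℕ.z<s a+1<n link

  G : Graph n
  G = record
    { adj   = λ i j → does (adj? i j)
    ; sym   = λ i j → does-⇔ (Link-sym ⊎-⇔ Link-sym) (adj? i j) (adj? j i)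
    ; irref = λ i → dec-false (adj? i i) (Adj-irrefl i)
    }

  applyA-circulant : ∀ y i →
    applyA G y i ≡ (y (i ⊕ a) ℚ.+ y (i ⊖ a)) ℚ.+ (y (i ⊕ suc a) ℚ.+ y (i ⊖ suc a))
  applyA-circulant y i = begin
    sumOver (adj? i) y
      ≡⟨ sumOver-⊎ (link? a i) (link? (suc a) i) (λ j → Link-disjoint 0<a (ℕ.n<1+n a) a+a+1<n) y ⟩
    sumOver (link? a i) y ℚ.+ sumOver (link? (suc a) i) y
      ≡⟨ cong₂ ℚ._+_ (sumOver-link 0<a+a a+a<n y i) (sumOver-link ℕ.z<s 2a+2<n y i) ⟩
    (y (i ⊕ a) ℚ.+ y (i ⊖ a)) ℚ.+ (y (i ⊕ suc a) ℚ.+ y (i ⊖ suc a)) ∎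
    where
    open ≡-Reasoning
    0<a+a : 0 < a + a
    0<a+a = ℕ.<-≤-trans 0<a (ℕ.m≤m+n a a)
    a+a<n : a + a < n
    a+a<n = ℕ.<-trans (ℕ.+-monoʳ-< a (ℕ.n<1+n a)) a+a+1<n

  alt : Fin n → ℚ
  alt j = sgn (toℕ j)

  alt-square : ∀ j → alt j ℚ.* alt j ≡ 1ℚ
  alt-square j = sgn-square (toℕ j)

  alt-⊕ : ∀ j k → alt (j ⊕ k) ≡ sgn k ℚ.* alt j
  alt-⊕ j k = begin
    sgn (toℕ (j ⊕ k))             ≡⟨ cong sgn (toℕ-⊕ j k) ⟩
    sgn ((toℕ j + k) % n)         ≡⟨ sgn-%-even (S + e) (toℕ j + k) ⟩
    sgn (toℕ j + k)               ≡⟨ sgn-+ (toℕ j) k ⟩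
    alt j ℚ.* sgn k               ≡⟨ ℚ.*-comm (alt j) (sgn k) ⟩
    sgn k ℚ.* alt j               ∎
    where open ≡-Reasoning

  alt-⊖ : ∀ j k → alt (j ⊖ k) ≡ sgn k ℚ.* alt j
  alt-⊖ j k = begin
    alt (j ⊖ k)                         ≡⟨ ℚ.*-identityˡ (alt (j ⊖ k)) ⟨
    1ℚ ℚ.* alt (j ⊖ k)                  ≡⟨ cong (ℚ._* alt (j ⊖ k)) (sgn-square k) ⟨
    sgn k ℚ.* sgn k ℚ.* alt (j ⊖ k)     ≡⟨ ℚ.*-assoc (sgn k) (sgn k) (alt (j ⊖ k)) ⟩
    sgn k ℚ.* (sgn k ℚ.* alt (j ⊖ k))   ≡⟨ cong (sgn k ℚ.*_) (alt-⊕ (j ⊖ k) k) ⟨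
    sgn k ℚ.* alt (j ⊖ k ⊕ k)           ≡⟨ cong (λ i → sgn k ℚ.* alt i) (⊖-⊕ j k) ⟩
    sgn k ℚ.* alt j                     ∎
    where open ≡-Reasoning

  alt-ker : InKernel G alt
  alt-ker i = begin
    applyA G alt i
      ≡⟨ applyA-circulant alt i ⟩
    (alt (i ⊕ a) ℚ.+ alt (i ⊖ a)) ℚ.+ (alt (i ⊕ suc a) ℚ.+ alt (i ⊖ suc a))
      ≡⟨ cong₂ ℚ._+_ (cong₂ ℚ._+_ (alt-⊕ i a) (alt-⊖ i a))
                     (cong₂ ℚ._+_ (alt-⊕ i (suc a)) (alt-⊖ i (suc a))) ⟩
    (s ℚ.* x ℚ.+ s ℚ.* x) ℚ.+ (- s ℚ.* x ℚ.+ - s ℚ.* x)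
      ≡⟨ solve 2 (λ s x → (s :* x :+ s :* x) :+ ((:- s) :* x :+ (:- s) :* x) := con 0ℚ) refl s x ⟩
    0ℚ ∎
    where
    open ≡-Reasoning
    s x : ℚ
    s = sgn a
    x = alt i

  periodic-2 : ∀ {A : Set} {f : Fin n → A} → Periodic f (S + S) → Periodic f 2
  periodic-2 {f = f} f-2S = reduce e∈ refl
    where
    -- gcd (S + S) n = 2: n is 2S + 2 or 2S + 4, and in the latter case 4 divides 2S + 2.
    reduce : ∀ {k} → k ≡ 1 ⊎ k ≡ 2 → n ≡ 2 * (S + k) → Periodic f 2
    reduce (inj₁ refl) n≡ = periodic-cancelˡ f-2S (subst (Periodic f) (trans n≡ (n≡2S+2 a)) periodic-n)
      where
      n≡2S+2 : ∀ a → 2 * (suc (a + a) + 1) ≡ suc (a + a) + suc (a + a) + 2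
      n≡2S+2 = solve-∀
    reduce (inj₂ refl) n≡ = periodic-cancelˡ f-2S (subst (Periodic f) (2S+2≡ a) (periodic-*ˡ (suc a) f-4))
      where
      n≡2S+4 : ∀ a → 2 * (suc (a + a) + 2) ≡ suc (a + a) + suc (a + a) + 4
      n≡2S+4 = solve-∀
      2S+2≡ : ∀ a → suc a * 4 ≡ suc (a + a) + suc (a + a) + 2
      2S+2≡ = solve-∀
      f-4 : Periodic f 4
      f-4 = periodic-cancelˡ f-2S (subst (Periodic f) (trans n≡ (n≡2S+4 a)) periodic-n)

  module KernelVector (y : Fin n → ℚ) (y-ker : InKernel G y) where

    z : Fin n → ℚ
    z j = y j ℚ.+ y (j ⊕ 1)

    z-⊕S : ∀ j → z (j ⊕ S) ≡ - z j
    z-⊕S j = inverseˡ-unique (z (j ⊕ S)) (z j) (begin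
      z (j ⊕ S) ℚ.+ z j
        ≡⟨ solve 4 (λ A B C D → (A :+ C) :+ (D :+ B) := (A :+ B) :+ (C :+ D)) refl
                   (y (j ⊕ S)) (y (j ⊕ 1)) (y (j ⊕ S ⊕ 1)) (y j) ⟩
      (y (j ⊕ S) ℚ.+ y (j ⊕ 1)) ℚ.+ (y (j ⊕ S ⊕ 1) ℚ.+ y j)
        ≡⟨ cong₂ ℚ._+_ (cong₂ ℚ._+_ (cong y i⊕a) (cong y i⊖a))
                       (cong₂ ℚ._+_ (cong y i⊕sa) (cong y (⊕-⊖ j (suc a)))) ⟨
      (y (i ⊕ a) ℚ.+ y (i ⊖ a)) ℚ.+ (y (i ⊕ suc a) ℚ.+ y (i ⊖ suc a))
        ≡⟨ applyA-circulant y i ⟨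
      applyA G y i
        ≡⟨ y-ker i ⟩
      0ℚ ∎)
      where
      open ≡-Reasoning
      i : Fin n
      i = j ⊕ suc a
      i⊕a : i ⊕ a ≡ j ⊕ S
      i⊕a = ⊕-assoc j (suc a) a
      i⊖a : i ⊖ a ≡ j ⊕ 1
      i⊖a = trans (cong (_⊖ a) (sym (⊕-assoc j 1 a))) (⊕-⊖ (j ⊕ 1) a)
      i⊕sa : i ⊕ suc a ≡ j ⊕ S ⊕ 1
      i⊕sa = trans (⊕-assoc j (suc a) (suc a)) (trans (cong (λ k → j ⊕ suc k) (ℕ.+-suc a a)) (⊕-suc j S))

    z-periodic-2S : Periodic z (S + S)
    z-periodic-2S j = begin
      z (j ⊕ (S + S))   ≡⟨ cong z (⊕-assoc j S S) ⟨
      z (j ⊕ S ⊕ S)     ≡⟨ z-⊕S (j ⊕ S) ⟩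
      - z (j ⊕ S)       ≡⟨ cong -_ (z-⊕S j) ⟩
      - - z j           ≡⟨ ⁻¹-involutive (z j) ⟩
      z j               ∎
      where open ≡-Reasoning

    z-⊕1 : ∀ j → z (j ⊕ 1) ≡ - z j
    z-⊕1 j = begin
      z (j ⊕ 1)             ≡⟨ z-periodic-a+a (j ⊕ 1) ⟨
      z (j ⊕ 1 ⊕ (a + a))   ≡⟨ cong z (⊕-assoc j 1 (a + a)) ⟩
      z (j ⊕ S)             ≡⟨ z-⊕S j ⟩
      - z j                 ∎
      where
      open ≡-Reasoning
      a*2≡a+a : ∀ a → a * 2 ≡ a + a
      a*2≡a+a = solve-∀
      z-periodic-a+a : Periodic z (a + a)
      z-periodic-a+a = subst (Periodic z) (a*2≡a+a a) (periodic-*ˡ a (periodic-2 z-periodic-2S))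

    α : ℚ
    α = alt origin ℚ.* z origin

    alt·z-constant : ∀ j → alt j ℚ.* z j ≡ α
    alt·z-constant = ⊕1-invariant⇒constant (λ j → alt j ℚ.* z j) λ j → begin
      alt (j ⊕ 1) ℚ.* z (j ⊕ 1)        ≡⟨ cong₂ ℚ._*_ (alt-⊕ j 1) (z-⊕1 j) ⟩
      (- 1ℚ ℚ.* alt j) ℚ.* (- z j)     ≡⟨ solve 2 (λ x t → ((:- con 1ℚ) :* x) :* (:- t) := x :* t)
                                                  refl (alt j) (z j) ⟩
      alt j ℚ.* z j                    ∎
      where open ≡-Reasoning

    w : Fin n → ℚ
    w j = alt j ℚ.* y j

    w-drift : ∀ j → w (j ⊕ 1) ≡ w j ℚ.+ - α
    w-drift j = begin
      alt (j ⊕ 1) ℚ.* y (j ⊕ 1)         ≡⟨ cong (ℚ._* y (j ⊕ 1)) (alt-⊕ j 1) ⟩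
      (- 1ℚ ℚ.* alt j) ℚ.* y (j ⊕ 1)
        ≡⟨ solve 3 (λ x y₀ y₁ → ((:- con 1ℚ) :* x) :* y₁ := x :* y₀ :+ :- (x :* (y₀ :+ y₁)))
                   refl (alt j) (y j) (y (j ⊕ 1)) ⟩
      w j ℚ.+ - (alt j ℚ.* z j)         ≡⟨ cong (λ t → w j ℚ.+ - t) (alt·z-constant j) ⟩
      w j ℚ.+ - α                       ∎
      where open ≡-Reasoning

    w-constant : ∀ j → w j ≡ w origin
    w-constant = ⊕1-invariant⇒constant w λ j → begin
      w (j ⊕ 1)        ≡⟨ w-drift j ⟩
      w j ℚ.+ - α      ≡⟨ cong (w j ℚ.+_) (⊕1-drift⇒zero w (- α) w-drift) ⟩
      w j ℚ.+ 0ℚ       ≡⟨ ℚ.+-identityʳ (w j) ⟩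
      w j              ∎
      where open ≡-Reasoning

    y≡w·alt : ∀ j → y j ≡ w origin ℚ.* alt j
    y≡w·alt j = begin
      y j                            ≡⟨ ℚ.*-identityˡ (y j) ⟨
      1ℚ ℚ.* y j                     ≡⟨ cong (ℚ._* y j) (alt-square j) ⟨
      (alt j ℚ.* alt j) ℚ.* y j      ≡⟨ solve 2 (λ x t → (x :* x) :* t := (x :* t) :* x) refl (alt j) (y j) ⟩
      w j ℚ.* alt j                  ≡⟨ cong (ℚ._* alt j) (w-constant j) ⟩
      w origin ℚ.* alt j             ∎
      where open ≡-Reasoning

  alt-spans-kernel : ∀ y → InKernel G y → ∃[ c ] (∀ j → y j ≡ c ℚ.* alt j)
  alt-spans-kernel y y-ker = w origin , y≡w·alt
    where open KernelVector y y-ker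

  Adj⇒adj : ∀ i j → Adj i j → adj G i j ≡ true
  Adj⇒adj i j = dec-true (adj? i j)

  adj⇒Adj : ∀ {i j} → adj G i j ≡ true → Adj i j
  adj⇒Adj {i} {j} = does-true⇒ (adj? i j)
    where
    does-true⇒ : ∀ {A : Set} (a? : Dec A) → does a? ≡ true → A
    does-true⇒ (yes a) _ = a

  connected : Connected G
  connected = connected-via-⊕1 G λ j →
    step {v = j ⊕ suc a} (Adj⇒adj j (j ⊕ suc a) (inj₂ (inj₁ refl)))
         (step {v = j ⊕ 1} (Adj⇒adj (j ⊕ suc a) (j ⊕ 1) (inj₁ (inj₂ (sym (⊕-assoc j 1 a))))) here)

  rotationAut : ℕ → Aut G
  rotationAut k = rotation k , λ i j →
    does-⇔ (Link-⊕ a k ⊎-⇔ Link-⊕ (suc a) k) (adj? (i ⊕ k) (j ⊕ k)) (adj? i j)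

  vertexOrbits : o-v G 1
  vertexOrbits = (λ _ → origin) , (λ v → zero , rotationAut (toℕ v) , origin-⊕ v) , λ { zero zero _ → refl }

  edgeRep : Fin 2 → Edge G
  edgeRep zero       = (origin , origin ⊕ a) , Adj⇒adj origin (origin ⊕ a) (inj₁ (inj₁ refl))
  edgeRep (suc zero) = (origin , origin ⊕ suc a) , Adj⇒adj origin (origin ⊕ suc a) (inj₂ (inj₁ refl))

  rotateOnto : ∀ {p u v} → Link p u v → Σ (Aut G) λ (σ , _) →
               (σ ⟨$⟩ʳ origin ≡ u × σ ⟨$⟩ʳ (origin ⊕ p) ≡ v) ⊎
               (σ ⟨$⟩ʳ origin ≡ v × σ ⟨$⟩ʳ (origin ⊕ p) ≡ u)
  rotateOnto {p} {u} {v} (inj₁ v≡u⊕p) =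
    rotationAut (toℕ u) , inj₁ (origin-⊕ u , trans (origin-⊕-⊕ u p) (sym v≡u⊕p))
  rotateOnto {p} {u} {v} (inj₂ u≡v⊕p) =
    rotationAut (toℕ v) , inj₂ (origin-⊕ v , trans (origin-⊕-⊕ v p) (sym u≡v⊕p))

  edgeRep-covers : ∀ e → ∃[ r ] EdgeOrbitRel G (edgeRep r) e
  edgeRep-covers ((u , v) , uv) with adj⇒Adj uv
  ... | inj₁ link = zero , rotateOnto link
  ... | inj₂ link = suc zero , rotateOnto link

  open SignKernel G alt alt-square alt-ker alt-spans-kernel

  edgeRep-products : edgeProduct (edgeRep (suc zero)) ≡ - edgeProduct (edgeRep zero)
  edgeRep-products = begin
    alt origin ℚ.* alt (origin ⊕ suc a)           ≡⟨ cong (λ j → alt origin ℚ.* alt j) (⊕-suc origin a) ⟩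
    alt origin ℚ.* alt (origin ⊕ a ⊕ 1)           ≡⟨ cong (alt origin ℚ.*_) (alt-⊕ (origin ⊕ a) 1) ⟩
    alt origin ℚ.* (- 1ℚ ℚ.* alt (origin ⊕ a))    ≡⟨ solve 2 (λ s t → s :* ((:- con 1ℚ) :* t) := :- (s :* t))
                                                             refl (alt origin) (alt (origin ⊕ a)) ⟩
    - (alt origin ℚ.* alt (origin ⊕ a))           ∎
    where open ≡-Reasoning

  edgeRep-distinct : ∀ r s → EdgeOrbitRel G (edgeRep r) (edgeRep s) → r ≡ s
  edgeRep-distinct zero       zero       _   = refl
  edgeRep-distinct (suc zero) (suc zero) _   = refl
  edgeRep-distinct zero       (suc zero) rel = ⊥-elim (square-one⇒≢-neg (edgeProduct-square (edgeRep zero))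
    (trans (edgeOrbit-preserves-product (edgeRep zero) (edgeRep (suc zero)) rel) edgeRep-products))
  edgeRep-distinct (suc zero) zero       rel = ⊥-elim (square-one⇒≢-neg (edgeProduct-square (edgeRep zero))
    (sym (trans (sym edgeRep-products) (edgeOrbit-preserves-product (edgeRep (suc zero)) (edgeRep zero) rel))))

  edgeOrbits : o-e G 2
  edgeOrbits = edgeRep , edgeRep-covers , edgeRep-distinct

  isNut : IsNut G
  isNut = connected , nutKernel

4+k≡2a+1+e : ∀ k → ∃[ a ] ∃[ e ] 0 < a × (e ≡ 1 ⊎ e ≡ 2) × 4 + k ≡ suc (a + a) + e
4+k≡2a+1+e 0 = 1 , 1 , ℕ.z<s , inj₁ refl , refl
4+k≡2a+1+e 1 = 1 , 2 , ℕ.z<s , inj₂ refl , refl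
4+k≡2a+1+e (suc (suc k)) with 4+k≡2a+1+e k
... | a , e , _ , e∈ , 4+k≡ =
  suc a , e , ℕ.z<s , e∈ , trans (cong (2 +_) 4+k≡) (cong (λ t → suc (suc t + e)) (sym (ℕ.+-suc a a)))

theorem10 : (m : ℕ) → 8 ≤ 2 * m →
    Σ (Graph (2 * m)) λ G → IsNut G × o-v G 1 × o-e G 2
theorem10 m 8≤2m with 4+k≡2a+1+e (m ∸ 4)
... | a , e , 0<a , e∈ , 4+k≡ = subst Goal m≡ (G , isNut , vertexOrbits , edgeOrbits)
  where
  open Circulant a e 0<a e∈
  Goal : ℕ → Set
  Goal k = Σ (Graph (2 * k)) λ G → IsNut G × o-v G 1 × o-e G 2
  m≡ : suc (a + a) + e ≡ m
  m≡ = trans (sym 4+k≡) (ℕ.m+[n∸m]≡n {4} (ℕ.*-cancelˡ-≤ 2 8≤2m))
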